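{- For every connected graph $H$ and every connected graph $G$ of order $n\ge 2$, $\dim_l(G\odot H)\ge n\cdot\dim_l(H)$.
   Context: All graphs are finite and simple. For a connected graph $X$, $d_X(x,y)$ is the length of a shortest path between $x$ and $y$. A vertex $w$ distinguishes two vertices $x,y$ if $d_X(w,x)\ne d_X(w,y)$. A set $S\subseteq V(X)$ is a local metric generator for $X$ if every two adjacent vertices of $X$ are distinguished by some vertex of $S$; a local metric generator of minimum cardinality is a local metric basis, and its cardinality is the local metric dimension $\dim_l(X)$. For a graph $G$ of order $n$ with vertices $v_1,\dots,v_n$ and a graph $H$, the corona product $G\odot H$ is obtained from one copy of $G$ and $n$ disjoint copies $H_1,\dots,H_n$ of $H$ by joining $v_i$ by an edge to every vertex of $H_i$. -}

module Defs where

open import Data.Nat using (ℕ; zero; suc; _+_; _*_; _≤_)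
open import Data.Fin using (Fin; splitAt; remQuot)
open import Data.Fin.Subset using (Subset; _∈_; ∣_∣)
open import Data.Product using (Σ; ∃; _×_; _,_)
open import Data.Sum using (_⊎_; inj₁; inj₂)
open import Relation.Binary.PropositionalEquality using (_≡_; _≢_)
open import Relation.Nullary using (¬_)

record Graph : Set₁ where
  constructor graph
  field
    size : ℕ
    Adj  : Fin size → Fin size → Set
open Graph public

record IsSimple (X : Graph) : Set where
  field
    sym     : ∀ x y → Adj X x y → Adj X y x
    irrefl  : ∀ x → ¬ Adj X x x

data Walk (X : Graph) : Fin (size X) → Fin (size X) → ℕ → Set where
  nil  : ∀ {x} → Walk X x x 0
  cons : ∀ {x y z k} → Adj X x y → Walk X y z k → Walk X x z (suc k)

Connected : Graph → Set
Connected X = ∀ x y → ∃ λ k → Walk X x y k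

IsDist : (X : Graph) → Fin (size X) → Fin (size X) → ℕ → Set
IsDist X x y d = Walk X x y d × (∀ k → Walk X x y k → d ≤ k)

Distinguishes : (X : Graph) → (w x y : Fin (size X)) → Set
Distinguishes X w x y =
  Σ ℕ λ d₁ → Σ ℕ λ d₂ → IsDist X w x d₁ × IsDist X w y d₂ × d₁ ≢ d₂

IsLocalMetricGenerator : (X : Graph) → Subset (size X) → Set
IsLocalMetricGenerator X S =
  ∀ x y → Adj X x y → Σ (Fin (size X)) λ w → w ∈ S × Distinguishes X w x y

IsLocalMetricDim : (X : Graph) → ℕ → Set
IsLocalMetricDim X k =
  (Σ (Subset (size X)) λ S → IsLocalMetricGenerator X S × ∣ S ∣ ≡ k)
  × (∀ S → IsLocalMetricGenerator X S → k ≤ ∣ S ∣)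

-- Corona product G ⊙ H.  Vertex set Fin (n + n * m): the first n vertices are
-- v_1..v_n of G; a vertex in the second block decodes (remQuot) to (i , a),
-- meaning vertex a of the copy H_i.
coronaAdj : (G H : Graph) → Fin (size G + size G * size H) → Fin (size G + size G * size H) → Set
coronaAdj G H u v with splitAt (size G) u | splitAt (size G) v
... | inj₁ i | inj₁ j = Adj G i j
... | inj₁ i | inj₂ q with remQuot {size G} (size H) q
...   | (j , _) = i ≡ j
coronaAdj G H u v | inj₂ p | inj₁ j with remQuot {size G} (size H) p
...   | (i , _) = i ≡ j
coronaAdj G H u v | inj₂ p | inj₂ q with remQuot {size G} (size H) p | remQuot {size G} (size H) q
...   | (i , a) | (j , b) = i ≡ j × Adj H a b

_⊙_ : Graph → Graph → Graph
G ⊙ H = graph (size G + size G * size H) (coronaAdj G H)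

module Submission where

open import Defs
open import Data.Nat using (ℕ; zero; suc; _+_; _*_; _≤_; _<_; z≤n; s≤s)
open import Data.Nat.Properties using (≤-trans; ≤-antisym; +-mono-≤; m≤n+m)
open import Data.Bool using (Bool; true; false)
open import Data.Fin as F using (Fin; _↑ˡ_; _↑ʳ_; splitAt; combine; join; _≟_)
open import Data.Fin.Properties
  using (splitAt-↑ˡ; splitAt-↑ʳ; join-splitAt; remQuot-combine; combine-remQuot; ↑ʳ-injective; combine-injective)
open import Data.Fin.Subset using (Subset; _∈_; ∣_∣)
open import Data.Vec using (tabulate; lookup)
open import Data.Vec.Properties using ([]=⇒lookup; lookup⇒[]=; lookup∘tabulate; tabulate∘lookup)
open import Data.Product using (Σ; _×_; _,_; proj₁; proj₂; swap)
open import Data.Sum using (inj₁; inj₂)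
open import Data.Empty using (⊥-elim)
open import Relation.Nullary using (¬_; yes; no)
open import Relation.Binary.PropositionalEquality

-- Let S be a local metric generator of G ⊙ H.  A vertex outside the copy H_i
-- reaches H_i only through the hub v_i, so it sees all of H_i at the same
-- distance and distinguishes no two of its vertices.  Inside H_i the corona
-- distance is min(d_H, 2), and for adjacent a, b a distinguishing vertex has
-- the same distances in H_i as in G ⊙ H.  Hence S ∩ H_i is a local metric
-- generator of H for every i, and ∣ S ∣ ≥ Σᵢ ∣ S ∩ H_i ∣ ≥ n · dim_l(H).

∣tabulate∣-+ : ∀ m n (p : Fin (m + n) → Bool) →
               ∣ tabulate p ∣ ≡ ∣ tabulate (λ i → p (i ↑ˡ n)) ∣ + ∣ tabulate (λ j → p (m ↑ʳ j)) ∣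
∣tabulate∣-+ zero    n p = refl
∣tabulate∣-+ (suc m) n p with p F.zero | ∣tabulate∣-+ m n (λ i → p (F.suc i))
... | true  | eq = cong suc eq
... | false | eq = eq

∣tabulate∣-combine : ∀ n m k (p : Fin (n * m) → Bool) →
                     (∀ i → k ≤ ∣ tabulate (λ a → p (combine {n} {m} i a)) ∣) → n * k ≤ ∣ tabulate p ∣
∣tabulate∣-combine zero    m k p blocks = z≤n
∣tabulate∣-combine (suc n) m k p blocks = begin
  k + n * k                                                            ≤⟨ +-mono-≤ (blocks F.zero) rest ⟩
  ∣ tabulate (λ a → p (a ↑ˡ (n * m))) ∣ + ∣ tabulate (λ j → p (m ↑ʳ j)) ∣ ≡⟨ ∣tabulate∣-+ m (n * m) p ⟨
  ∣ tabulate p ∣                                                       ∎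
  where
  open Data.Nat.Properties.≤-Reasoning
  rest : n * k ≤ ∣ tabulate (λ j → p (m ↑ʳ j)) ∣
  rest = ∣tabulate∣-combine n m k (λ j → p (m ↑ʳ j)) (λ i → blocks (F.suc i))

dist-refl : ∀ {X x} → IsDist X x x 0
dist-refl = nil , λ _ _ → z≤n

walk₀⇒≡ : ∀ {X x y} → Walk X x y 0 → x ≡ y
walk₀⇒≡ nil = refl

walk₁⇒adj : ∀ {X x y} → Walk X x y 1 → Adj X x y
walk₁⇒adj (cons p nil) = p

adj⇒dist₁ : ∀ {X x y} → IsSimple X → Adj X x y → IsDist X x y 1
adj⇒dist₁ {X} {x} sX p = cons p nil , longer
  where
  longer : ∀ k → Walk X x _ k → 1 ≤ k
  longer zero    w with walk₀⇒≡ w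
  ... | refl = ⊥-elim (IsSimple.irrefl sX x p)
  longer (suc k) w = s≤s z≤n

nonadj⇒dist₂ : ∀ {X x y} → x ≢ y → ¬ Adj X x y → Walk X x y 2 → IsDist X x y 2
nonadj⇒dist₂ {X} {x} {y} x≢y ¬xy w = w , longer
  where
  longer : ∀ k → Walk X x y k → 2 ≤ k
  longer zero          w = ⊥-elim (x≢y (walk₀⇒≡ w))
  longer (suc zero)    w = ⊥-elim (¬xy (walk₁⇒adj w))
  longer (suc (suc k)) w = s≤s (s≤s z≤n)

ShorterWalk : (X : Graph) → Fin (size X) → Fin (size X) → ℕ → Set
ShorterWalk X x y k = Σ ℕ λ j → Walk X x y j × j < k

cons-shorter : ∀ {X x y z k} → Adj X x y → ShorterWalk X y z k → ShorterWalk X x z (suc k)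
cons-shorter p (j , w , j<k) = suc j , cons p w , s≤s j<k

snoc : ∀ {X x y z k} → Walk X x y k → Adj X y z → Walk X x z (suc k)
snoc nil        p = cons p nil
snoc (cons q w) p = cons q (snoc w p)

module Corona (G H : Graph) where

  private
    n h : ℕ
    n = size G
    h = size H
    X : Graph
    X = G ⊙ H

  Vertex : Set
  Vertex = Fin (size X)

  hub : Fin n → Vertex
  hub i = i ↑ˡ (n * h)

  copy : Fin n → Fin h → Vertex
  copy i a = n ↑ʳ combine i a

  data View : Vertex → Set where
    hubᵛ  : ∀ i → View (hub i)
    copyᵛ : ∀ i a → View (copy i a)

  view : ∀ x → View x
  view x = subst View (join-splitAt n (n * h) x) (view-join (splitAt n x))
    where
    view-join : ∀ s → View (join n (n * h) s)
    view-join (inj₁ i) = hubᵛ i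
    view-join (inj₂ q) = subst View (cong (n ↑ʳ_) (combine-remQuot {n} h q)) (copyᵛ _ _)

  copy-injective : ∀ {i j a b} → copy i a ≡ copy j b → i ≡ j × a ≡ b
  copy-injective {i} {j} {a} {b} e = combine-injective i a j b (↑ʳ-injective n _ _ e)

  hub≢copy : ∀ g i a → hub g ≢ copy i a
  hub≢copy g i a e with trans (sym (splitAt-↑ˡ n g (n * h)))
                         (trans (cong (splitAt n) e) (splitAt-↑ʳ n (n * h) (combine i a)))
  ... | ()

  copy≢copy : ∀ {j i} → j ≢ i → ∀ c a → copy j c ≢ copy i a
  copy≢copy j≢i c a e = j≢i (proj₁ (copy-injective e))

  -- remQuot in coronaAdj unfolds to swap ∘ quotRem, so rewrites must target quotRem.
  private
    quotRem-combine : ∀ i a → F.quotRem {n} h (combine i a) ≡ (a , i)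
    quotRem-combine i a = cong swap (remQuot-combine i a)

  hub-adj-copy : ∀ i a → Adj X (hub i) (copy i a)
  hub-adj-copy i a rewrite splitAt-↑ˡ n i (n * h) | splitAt-↑ʳ n (n * h) (combine i a)
    | quotRem-combine i a = refl

  copy-adj-hub : ∀ i a → Adj X (copy i a) (hub i)
  copy-adj-hub i a rewrite splitAt-↑ˡ n i (n * h) | splitAt-↑ʳ n (n * h) (combine i a)
    | quotRem-combine i a = refl

  copy-adj-copy : ∀ i {a b} → Adj H a b → Adj X (copy i a) (copy i b)
  copy-adj-copy i {a} {b} p rewrite splitAt-↑ʳ n (n * h) (combine i a)
    | splitAt-↑ʳ n (n * h) (combine i b) | quotRem-combine i a | quotRem-combine i b = refl , p

  copy-adj-copy⁻¹ : ∀ i j a b → Adj X (copy i a) (copy j b) → i ≡ j × Adj H a b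
  copy-adj-copy⁻¹ i j a b rewrite splitAt-↑ʳ n (n * h) (combine i a)
    | splitAt-↑ʳ n (n * h) (combine j b) | quotRem-combine i a | quotRem-combine j b = λ p → p

  hub-adj-copy⁻¹ : ∀ g i a → Adj X (hub g) (copy i a) → g ≡ i
  hub-adj-copy⁻¹ g i a rewrite splitAt-↑ˡ n g (n * h) | splitAt-↑ʳ n (n * h) (combine i a)
    | quotRem-combine i a = λ p → p

  OutsideCopy : Fin n → Vertex → Set
  OutsideCopy i x = ∀ a → x ≢ copy i a

  outside-adj-copy⇒hub : ∀ {x i a} → OutsideCopy i x → Adj X x (copy i a) → x ≡ hub i
  outside-adj-copy⇒hub {x} {i} {a} out p with view x
  ... | hubᵛ g = cong hub (hub-adj-copy⁻¹ g i a p)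
  ... | copyᵛ j c with copy-adj-copy⁻¹ j i c a p
  ...   | refl , _ = ⊥-elim (out c refl)

  walk-into-copy-via-hub : ∀ {x i a k} → OutsideCopy i x → Walk X x (copy i a) k →
                           ShorterWalk X x (hub i) k
  walk-into-copy-via-hub out nil = ⊥-elim (out _ refl)
  walk-into-copy-via-hub {x} {i} out (cons {y = y} p w) with view y
  ... | hubᵛ g = cons-shorter p (walk-into-copy-via-hub (hub≢copy g i) w)
  ... | copyᵛ j d with j ≟ i
  ...   | no j≢i = cons-shorter p (walk-into-copy-via-hub (copy≢copy j≢i d) w)
  ...   | yes refl = 0 , subst (λ z → Walk X x z 0) (outside-adj-copy⇒hub out p) nil , s≤s z≤n

  outside-dist-≤ : ∀ {x i a b d₁ d₂} → OutsideCopy i x →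
                   IsDist X x (copy i a) d₁ → IsDist X x (copy i b) d₂ → d₂ ≤ d₁
  outside-dist-≤ {b = b} out (w₁ , _) (_ , shortest₂) with walk-into-copy-via-hub out w₁
  ... | j , w , j<d₁ = ≤-trans (shortest₂ _ (snoc w (hub-adj-copy _ b))) j<d₁

  outside-¬distinguishes : ∀ {x i a b} → OutsideCopy i x → ¬ Distinguishes X x (copy i a) (copy i b)
  outside-¬distinguishes out (_ , _ , D₁ , D₂ , d₁≢d₂) =
    d₁≢d₂ (≤-antisym (outside-dist-≤ out D₂ D₁) (outside-dist-≤ out D₁ D₂))

  copy-dist≤2 : ∀ {i c a d} → IsDist X (copy i c) (copy i a) d → d ≤ 2
  copy-dist≤2 {i} {c} {a} (_ , shortest) =
    shortest 2 (cons (copy-adj-hub i c) (cons (hub-adj-copy i a) nil))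

  copy-dist⇒dist : IsSimple H → ∀ {i a b c} d₁ d₂ → Adj H a b →
                   IsDist X (copy i c) (copy i a) d₁ → IsDist X (copy i c) (copy i b) d₂ →
                   d₁ ≢ d₂ → IsDist H c a d₁
  copy-dist⇒dist sH zero _ _ (w₁ , _) _ _ with copy-injective (walk₀⇒≡ w₁)
  ... | _ , refl = dist-refl
  copy-dist⇒dist sH {i} {a} {c = c} 1 _ _ (w₁ , _) _ _ =
    adj⇒dist₁ sH (proj₂ (copy-adj-copy⁻¹ i i c a (walk₁⇒adj w₁)))
  copy-dist⇒dist sH {i} {a} {b} {c} 2 d₂ ab (_ , shortest₁) D₂ 2≢d₂ =
    nonadj⇒dist₂ c≢a ¬ca (via-b d₂ D₂ 2≢d₂)
    where
    c≢a : c ≢ a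
    c≢a refl with shortest₁ 0 nil
    ... | ()
    ¬ca : ¬ Adj H c a
    ¬ca p with shortest₁ 1 (cons (copy-adj-copy i p) nil)
    ... | s≤s ()
    -- d_X(c, a) = 2 forces d_X(c, b) ≤ 1, and then c, b, a is a walk in H.
    via-b : ∀ d₂ → IsDist X (copy i c) (copy i b) d₂ → 2 ≢ d₂ → Walk H c a 2
    via-b zero (w₂ , _) _ with copy-injective (walk₀⇒≡ w₂)
    ... | _ , refl = ⊥-elim (¬ca (IsSimple.sym sH _ _ ab))
    via-b 1 (w₂ , _) _ =
      cons (proj₂ (copy-adj-copy⁻¹ i i c b (walk₁⇒adj w₂))) (cons (IsSimple.sym sH _ _ ab) nil)
    via-b 2 _ 2≢2 = ⊥-elim (2≢2 refl)
    via-b (suc (suc (suc _))) D₂ _ with copy-dist≤2 D₂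
    ... | s≤s (s≤s ())
  copy-dist⇒dist sH (suc (suc (suc _))) _ _ D₁ _ _ with copy-dist≤2 D₁
  ... | s≤s (s≤s ())

  copy-distinguishes⇒distinguishes : IsSimple H → ∀ {i a b c} → Adj H a b →
    Distinguishes X (copy i c) (copy i a) (copy i b) → Distinguishes H c a b
  copy-distinguishes⇒distinguishes sH ab (d₁ , d₂ , D₁ , D₂ , d₁≢d₂) =
    d₁ , d₂ , copy-dist⇒dist sH d₁ d₂ ab D₁ D₂ d₁≢d₂
            , copy-dist⇒dist sH d₂ d₁ (IsSimple.sym sH _ _ ab) D₂ D₁ (λ e → d₁≢d₂ (sym e)) , d₁≢d₂

  restrict : Subset (size X) → Fin n → Subset h
  restrict S i = tabulate (λ a → lookup S (copy i a))

  ∈-restrict : ∀ {S i a} → copy i a ∈ S → a ∈ restrict S i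
  ∈-restrict {S} {i} {a} a∈S = lookup⇒[]= a (restrict S i) (trans (lookup∘tabulate _ a) ([]=⇒lookup a∈S))

  restrict-generator : IsSimple H → ∀ S → IsLocalMetricGenerator X S →
                       ∀ i → IsLocalMetricGenerator H (restrict S i)
  restrict-generator sH S generator i a b ab with generator (copy i a) (copy i b) (copy-adj-copy i ab)
  ... | w , w∈S , w-dist with view w
  ...   | hubᵛ g = ⊥-elim (outside-¬distinguishes (hub≢copy g i) w-dist)
  ...   | copyᵛ j c with j ≟ i
  ...     | no j≢i   = ⊥-elim (outside-¬distinguishes (copy≢copy j≢i c) w-dist)
  ...     | yes refl = c , ∈-restrict w∈S , copy-distinguishes⇒distinguishes sH ab w-dist

  ∣restrict∣≥k⇒n*k≤∣S∣ : ∀ S k → (∀ i → k ≤ ∣ restrict S i ∣) → n * k ≤ ∣ S ∣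
  ∣restrict∣≥k⇒n*k≤∣S∣ S k blocks = begin
    n * k                                      ≤⟨ ∣tabulate∣-combine n h k (λ q → lookup S (n ↑ʳ q)) blocks ⟩
    ∣ tabulate (λ q → lookup S (n ↑ʳ q)) ∣      ≤⟨ m≤n+m _ _ ⟩
    ∣ tabulate (λ g → lookup S (g ↑ˡ (n * h))) ∣ + ∣ tabulate (λ q → lookup S (n ↑ʳ q)) ∣
                                               ≡⟨ ∣tabulate∣-+ n (n * h) (lookup S) ⟨
    ∣ tabulate (lookup S) ∣                     ≡⟨ cong ∣_∣ (tabulate∘lookup S) ⟩
    ∣ S ∣                                      ∎
    where open Data.Nat.Properties.≤-Reasoning

mainTheorem11 : (G H : Graph) → IsSimple G → IsSimple H
                → Connected G → Connected H → 2 ≤ size G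
                → (k m : ℕ) → IsLocalMetricDim H k → IsLocalMetricDim (G ⊙ H) m
                → size G * k ≤ m
mainTheorem11 G H _ sH _ _ _ k m (_ , minimalH) ((S , generator , refl) , _) =
  ∣restrict∣≥k⇒n*k≤∣S∣ S k (λ i → minimalH _ (restrict-generator sH S generator i))
  where open Corona G H
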